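{- Let $r \ge 1$, let $A$ be the $2^r \times r$ binary code matrix and $M = AA^T$. For $0 \le k \le r$ let $\mathfrak{m}_k$ be the $2^r \times \binom{r}{k}$ submatrix of $M$ consisting of the columns $M_{*,\ell}$ for which row $\ell$ of $A$ has exactly $k$ entries equal to $1$. If $k < 2^i$, then $\mathfrak{m}_k^{[i]} = \mathbf{0}$ for all $i \ge 1$.
   Context: The binary code matrix $A \in \{0,1\}^{2^r \times r}$ is the matrix whose rows are all $2^r$ distinct vectors in $\{0,1\}^r$ (the binary expansions of $0,1,\ldots,2^r-1$), ordered so that rows with fewer nonzero entries come first. For a prime $p$ and an integer matrix $X$ with nonnegative entries, its $p$-adic expansion is $X = X^{[0]} + pX^{[1]} + p^2 X^{[2]} + \cdots$ with each $X^{[i]}$ having entries in $\{0,\ldots,p-1\}$ (the $i$th base-$p$ digit, taken entrywise); here $p = 2$. -}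

module Defs where

open import Data.Nat using (ℕ; zero; suc; _+_; _*_; _^_; _<_; _≤_)
open import Data.Nat.DivMod using (_/_; _%_)
open import Data.Fin using (Fin)
open import Data.Bool using (Bool; true; false; if_then_else_)
open import Data.Product using (Σ; _×_)
open import Data.Vec.Functional using (Vector; foldr)
open import Relation.Binary.PropositionalEquality using (_≡_)
open import Function.Definitions using (Bijective)

Matrix : ℕ → ℕ → Set
Matrix m n = Fin m → Fin n → ℕ

∑ : ∀ {n} → Vector ℕ n → ℕ
∑ = foldr _+_ 0

transpose : ∀ {m n} → Matrix m n → Matrix n m
transpose X j i = X i j

infixl 7 _⊗_
_⊗_ : ∀ {m n p} → Matrix m n → Matrix n p → Matrix m p
(X ⊗ Y) i j = ∑ (λ t → X i t * Y t j)

weight : ∀ {r} → Vector Bool r → ℕ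
weight v = ∑ (λ t → if v t then 1 else 0)

IsBinaryCodeOrdering : (r : ℕ) → (Fin (2 ^ r) → Vector Bool r) → Set
IsBinaryCodeOrdering r e =
  Bijective _≡_ _≡_ e ×
  (∀ (a b : Fin (2 ^ r)) → Data.Fin._<_ a b → weight (e a) ≤ weight (e b))

codeMatrix : ∀ r → (Fin (2 ^ r) → Vector Bool r) → Matrix (2 ^ r) r
codeMatrix r e a t = if e a t then 1 else 0

Mmat : ∀ r → (Fin (2 ^ r) → Vector Bool r) → Matrix (2 ^ r) (2 ^ r)
Mmat r e = codeMatrix r e ⊗ transpose (codeMatrix r e)

ColIdx : ∀ r → (Fin (2 ^ r) → Vector Bool r) → ℕ → Set
ColIdx r e k = Σ (Fin (2 ^ r)) (λ ℓ → weight (e ℓ) ≡ k)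

𝔪 : ∀ r → (e : Fin (2 ^ r) → Vector Bool r) → (k : ℕ) → Fin (2 ^ r) → ColIdx r e k → ℕ
𝔪 r e k a c = Mmat r e a (Data.Product.proj₁ c)

digit2 : ℕ → ℕ → ℕ
digit2 zero x = x % 2
digit2 (suc i) x = digit2 i (x / 2)

digitMat : ∀ {R C : Set} → ℕ → (R → C → ℕ) → R → C → ℕ
digitMat i X a c = digit2 i (X a c)

{-# OPTIONS --safe #-}
module Submission where

-- An entry M a ℓ counts the common ones of rows a and ℓ of A, so it is at
-- most the weight k of row ℓ; since k < 2 ^ i, every base-2 digit of index
-- i or more vanishes.

open import Defs
open import Data.Nat using (ℕ; zero; suc; _*_; _^_; _<_; _≤_; z≤n; s≤s)
open import Data.Nat.Properties using (≤-<-trans; +-mono-≤; *-comm)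
open import Data.Nat.DivMod using (_/_; m<n*o⇒m/o<n)
open import Data.Fin using (Fin; zero; suc)
open import Data.Bool using (Bool; true; false; if_then_else_)
open import Data.Product using (_,_)
open import Data.Vec.Functional using (Vector)
open import Relation.Binary.PropositionalEquality using (_≡_; refl; subst)

digit2-< : ∀ i x → x < 2 ^ i → digit2 i x ≡ 0
digit2-< zero zero    _ = refl
digit2-< zero (suc x) (s≤s ())
digit2-< (suc i) x x<2^1+i =
  digit2-< i (x / 2) (m<n*o⇒m/o<n (subst (x <_) (*-comm 2 (2 ^ i)) x<2^1+i))

∑-mono-≤ : ∀ {n} {f g : Vector ℕ n} → (∀ t → f t ≤ g t) → ∑ f ≤ ∑ g
∑-mono-≤ {zero}  f≤g = z≤n
∑-mono-≤ {suc n} f≤g = +-mono-≤ (f≤g zero) (∑-mono-≤ (λ t → f≤g (suc t)))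

indicator : Bool → ℕ
indicator b = if b then 1 else 0

indicator-*-≤ʳ : ∀ b c → indicator b * indicator c ≤ indicator c
indicator-*-≤ʳ false c     = z≤n
indicator-*-≤ʳ true  false = z≤n
indicator-*-≤ʳ true  true  = s≤s z≤n

Mmat-≤-weight : ∀ r (e : Fin (2 ^ r) → Vector Bool r) a ℓ → Mmat r e a ℓ ≤ weight (e ℓ)
Mmat-≤-weight r e a ℓ = ∑-mono-≤ (λ t → indicator-*-≤ʳ (e a t) (e ℓ t))

lemma11 : (r : ℕ) → 1 ≤ r →
    (e : Fin (2 ^ r) → Vector Bool r) → IsBinaryCodeOrdering r e →
    (k : ℕ) → k ≤ r → (i : ℕ) → 1 ≤ i → k < 2 ^ i →
    (a : Fin (2 ^ r)) (c : ColIdx r e k) → digitMat i (𝔪 r e k) a c ≡ 0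
lemma11 r _ e _ k _ i _ k<2^i a (ℓ , weight≡k) =
  digit2-< i (Mmat r e a ℓ)
    (≤-<-trans (subst (Mmat r e a ℓ ≤_) weight≡k (Mmat-≤-weight r e a ℓ)) k<2^i)
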